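{- For all positive integers $m$ and $n$, $c_b(K_{m,n})=1$.
   Context: Bridge-burning Cops and Robbers is played on a finite graph $G$ by a team of cops and a single robber, with full information. First each cop chooses a starting vertex (several cops may share a vertex), then the robber chooses a starting vertex. The game then proceeds in rounds; in each round, first every cop either stays put or moves along an edge of the current graph to an adjacent vertex, and then the robber either stays put or moves along an edge of the current graph. Every edge traversed by the robber is immediately deleted from the graph (cop moves delete nothing). The cops win if at some moment some cop occupies the same vertex as the robber; the robber wins if he avoids this forever. $c_b(G)$ is the minimum number of cops for which the cops have a winning strategy. $K_{m,n}$ is the complete bipartite graph with parts of sizes $m$ and $n$. -}

module Defs where

open import Data.Nat using (ℕ; _+_; _<_; _<ᵇ_)
open import Data.Fin using (Fin; toℕ; _≟_)
open import Data.Bool using (Bool; true; false; _xor_; _∧_; _∨_; if_then_else_)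
open import Data.Product using (Σ; ∃; _×_; _,_)
open import Data.Sum using (_⊎_)
open import Relation.Nullary using (¬_)
open import Relation.Nullary.Decidable using (⌊_⌋)
open import Relation.Binary.PropositionalEquality using (_≡_)

-- A (current) graph on the vertex set Fin V, given by its adjacency
-- predicate (Bool-valued).  Graphs used here are simple: symmetric, loopless.
Graph : ℕ → Set
Graph V = Fin V → Fin V → Bool

side : ∀ {m n} → Fin (m + n) → Bool
side {m} i = toℕ i <ᵇ m

K : (m n : ℕ) → Graph (m + n)
K m n i j = side {m} {n} i xor side {m} {n} j

deleteEdge : ∀ {V} → Graph V → Fin V → Fin V → Graph V
deleteEdge A u v x y =
  if (⌊ x ≟ u ⌋ ∧ ⌊ y ≟ v ⌋) ∨ (⌊ x ≟ v ⌋ ∧ ⌊ y ≟ u ⌋) then false else A x y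

data CopStep {V} (A : Graph V) (c : Fin V) : Fin V → Set where
  stay : CopStep A c c
  move : ∀ {c'} → A c c' ≡ true → CopStep A c c'

data RobStep {V} (A : Graph V) (r : Fin V) : Fin V → Graph V → Set where
  stay : RobStep A r r A
  move : ∀ {r'} → A r r' ≡ true → RobStep A r r' (deleteEdge A r r')

Caught : ∀ {V k} → (Fin k → Fin V) → Fin V → Set
Caught {k = k} cops r = ∃ λ (i : Fin k) → cops i ≡ r

-- CopWin A cops r : at the start of a round (cops to move), with current
-- graph A, cop positions cops and robber position r, the cops can force a
-- capture in finitely many rounds (inductive = least fixed point, i.e. the
-- cops' attractor of the reachability game).
data CopWin {V k} (A : Graph V) (cops : Fin k → Fin V) (r : Fin V) : Set where
  round : (cops' : Fin k → Fin V)
        → (∀ i → CopStep A (cops i) (cops' i))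
        → (Caught cops' r
           ⊎ (∀ r' A' → RobStep A r r' A' → Caught cops' r' ⊎ CopWin A' cops' r'))
        → CopWin A cops r

CopsWin : ∀ {V} → Graph V → ℕ → Set
CopsWin {V} G k = Σ (Fin k → Fin V) λ cops →
  ∀ (r : Fin V) → Caught cops r ⊎ CopWin G cops r

BridgeBurningCopNumber : ∀ {V} → Graph V → ℕ → Set
BridgeBurningCopNumber G k = CopsWin G k × (∀ j → j < k → ¬ CopsWin G j)

module Submission where

-- Colour the vertices by the part they lie in.  The cop starts
-- at a vertex a and keeps a vertex b of the other colour in reserve.  A
-- robber starting on the other colour is caught in the first round.
-- Otherwise the robber shares the cop's colour; the cop steps from c to
-- the reserve vertex d, which is adjacent to the robber, so the robber
-- must flee along an edge to a vertex r' of d's colour.  This is the same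
-- situation with c and d swapped.  The robber only burns edges whose
-- endpoints differ from c and d, so these two vertices stay joined to
-- everything on the other side; and every flight burns an edge, so by
-- well-founded induction on the number of remaining edges the chase ends.

open import Defs
open import Data.Nat using (ℕ; zero; suc; _+_; _≤_; _<_; _<ᵇ_; z≤n; s≤s)
open import Data.Nat.Properties using (≤-refl; +-mono-≤; +-mono-<-≤; +-mono-≤-<; <ᵇ-reflects-<; m+n≮m)
open import Data.Nat.Induction using (<-wellFounded)
open import Data.Fin using (Fin; toℕ; _≟_; _↑ʳ_) renaming (zero to fzero; suc to fsuc)
open import Data.Fin.Properties using (toℕ-↑ʳ)
open import Data.Bool using (Bool; true; false; _xor_; if_then_else_)
open import Data.Bool.Properties using (xor-same) renaming (_≟_ to _≟ᵇ_)
open import Data.Product using (_,_)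
open import Data.Sum using (_⊎_; inj₁; inj₂)
open import Induction.WellFounded using (Acc; acc)
open import Relation.Nullary using (¬_; yes; no; contradiction)
open import Relation.Nullary.Reflects using (ofʸ)
open import Relation.Binary.PropositionalEquality using (_≡_; _≢_; refl; sym; trans; cong)

sumFin : ∀ {n} → (Fin n → ℕ) → ℕ
sumFin {zero}  f = 0
sumFin {suc n} f = f fzero + sumFin (λ i → f (fsuc i))

sumFin-mono : ∀ {n} {f g : Fin n → ℕ} → (∀ i → f i ≤ g i) → sumFin f ≤ sumFin g
sumFin-mono {zero}  f≤g = z≤n
sumFin-mono {suc n} f≤g = +-mono-≤ (f≤g fzero) (sumFin-mono (λ i → f≤g (fsuc i)))

sumFin-strict : ∀ {n} {f g : Fin n → ℕ} → (∀ i → f i ≤ g i) →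
                (j : Fin n) → f j < g j → sumFin f < sumFin g
sumFin-strict f≤g fzero    fj<gj =
  +-mono-<-≤ fj<gj (sumFin-mono (λ i → f≤g (fsuc i)))
sumFin-strict f≤g (fsuc j) fj<gj =
  +-mono-≤-< (f≤g fzero) (sumFin-strict (λ i → f≤g (fsuc i)) j fj<gj)

indicator : Bool → ℕ
indicator true  = 1
indicator false = 0

indicator-mono : ∀ {p q : Bool} → (p ≡ true → q ≡ true) → indicator p ≤ indicator q
indicator-mono {true}  p⇒q with p⇒q refl
... | refl = ≤-refl
indicator-mono {false} p⇒q = z≤n

-- The termination measure: the number of (ordered) adjacent pairs.
edgeCount : ∀ {V} → Graph V → ℕ
edgeCount A = sumFin (λ x → sumFin (λ y → indicator (A x y)))

_⊆_ : ∀ {V} → Graph V → Graph V → Set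
A ⊆ B = ∀ x y → A x y ≡ true → B x y ≡ true

edgeCount-strict : ∀ {V} {A B : Graph V} {u v} →
                   A ⊆ B → A u v ≡ false → B u v ≡ true → edgeCount A < edgeCount B
edgeCount-strict {A = A} {B} {u} {v} A⊆B Auv Buv =
  sumFin-strict (λ x → sumFin-mono (λ y → indicator-mono (A⊆B x y)))
    u (sumFin-strict (λ y → indicator-mono (A⊆B u y)) v indicator-drops)
  where
  indicator-drops : indicator (A u v) < indicator (B u v)
  indicator-drops rewrite Auv | Buv = s≤s z≤n

if-false-else-true : ∀ c {a : Bool} → (if c then false else a) ≡ true → a ≡ true
if-false-else-true false e  = e
if-false-else-true true  ()

deleteEdge-⊆ : ∀ {V} (A : Graph V) u v → deleteEdge A u v ⊆ A
deleteEdge-⊆ A u v x y = if-false-else-true _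

deleteEdge-removes : ∀ {V} (A : Graph V) u v → deleteEdge A u v u v ≡ false
deleteEdge-removes A u v with u ≟ u | v ≟ v
... | yes _ | yes _ = refl
... | no u≢u | _     = contradiction refl u≢u
... | yes _ | no v≢v = contradiction refl v≢v

deleteEdge-elsewhere : ∀ {V} (A : Graph V) {u v w} → w ≢ u → w ≢ v →
                       ∀ x → deleteEdge A u v w x ≡ A w x
deleteEdge-elsewhere A {u} {v} {w} w≢u w≢v x with w ≟ u | w ≟ v
... | no _    | no _    = refl
... | yes w≡u | _       = contradiction w≡u w≢u
... | no _    | yes w≡v = contradiction w≡v w≢v

deleteEdge-decreases : ∀ {V} (A : Graph V) {u v} → A u v ≡ true →
                       edgeCount (deleteEdge A u v) < edgeCount A
deleteEdge-decreases A {u} {v} Auv =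
  edgeCount-strict (deleteEdge-⊆ A u v) (deleteEdge-removes A u v) Auv

-- With no cops the robber simply stays put forever.
zeroCops-CopWin : ∀ {V} {A : Graph V} {cops : Fin 0 → Fin V} {r} → ¬ CopWin A cops r
zeroCops-CopWin (round _ _ (inj₁ (() , _)))
zeroCops-CopWin {A = A} {r = r} (round _ _ (inj₂ robber)) with robber r A stay
... | inj₁ (() , _)
... | inj₂ win = zeroCops-CopWin win

zeroCopsLose : ∀ {V} (G : Graph V) → Fin V → ¬ CopsWin G 0
zeroCopsLose G r (cops , strategy) with strategy r
... | inj₁ (() , _)
... | inj₂ win = zeroCops-CopWin win

xor≡true⇒≢ : ∀ {x y : Bool} → x xor y ≡ true → x ≢ y
xor≡true⇒≢ {x} xor≡true refl with () ← trans (sym (xor-same x)) xor≡true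

≢⇒xor≡true : ∀ {x y : Bool} → x ≢ y → x xor y ≡ true
≢⇒xor≡true {false} {false} x≢y = contradiction refl x≢y
≢⇒xor≡true {false} {true}  _   = refl
≢⇒xor≡true {true}  {false} _   = refl
≢⇒xor≡true {true}  {true}  x≢y = contradiction refl x≢y

≢-≢⇒≡ : ∀ {x y z : Bool} → x ≢ y → x ≢ z → y ≡ z
≢-≢⇒≡ {false} {false} x≢y _   = contradiction refl x≢y
≢-≢⇒≡ {false} {true}  {false} _ x≢z = contradiction refl x≢z
≢-≢⇒≡ {false} {true}  {true}  _ _   = refl
≢-≢⇒≡ {true}  {false} {false} _ _   = refl
≢-≢⇒≡ {true}  {false} {true}  _ x≢z = contradiction refl x≢z
≢-≢⇒≡ {true}  {true}  x≢y _   = contradiction refl x≢y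

module CompleteBipartite {V : ℕ} (colour : Fin V → Bool) where

  KB : Graph V
  KB i j = colour i xor colour j

  colour-≢ : ∀ {x y} → colour x ≢ colour y → x ≢ y
  colour-≢ c≢ x≡y = c≢ (cong colour x≡y)

  Intact : Graph V → Fin V → Set
  Intact A v = ∀ x → A v x ≡ KB v x

  intact-adjacent : ∀ (A : Graph V) {v w} → Intact A v → colour v ≢ colour w → A v w ≡ true
  intact-adjacent A {v} {w} v-intact v≢w = trans (v-intact w) (≢⇒xor≡true v≢w)

  intact-after-delete : ∀ (A : Graph V) {u v w} → Intact A w → w ≢ u → w ≢ v →
                        Intact (deleteEdge A u v) w
  intact-after-delete A w-intact w≢u w≢v x =
    trans (deleteEdge-elsewhere A w≢u w≢v x) (w-intact x)

  chase : (A : Graph V) → Acc _<_ (edgeCount A) → A ⊆ KB →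
          (c d r : Fin V) → colour c ≢ colour d → Intact A c → Intact A d →
          colour r ≡ colour c → r ≢ c → CopWin {k = 1} A (λ _ → c) r
  chase A (acc smaller) A⊆KB c d r c≢d c-intact d-intact r∼c r≢c =
    round (λ _ → d) (λ _ → move (intact-adjacent A c-intact c≢d)) (inj₂ robberReply)
    where
    d≢r : colour d ≢ colour r
    d≢r d≡r = c≢d (sym (trans d≡r r∼c))

    robberReply : ∀ r' A' → RobStep A r r' A' →
                  Caught (λ (_ : Fin 1) → d) r' ⊎ CopWin A' (λ _ → d) r'
    robberReply .r .A stay =
      inj₂ (round (λ _ → r) (λ _ → move (intact-adjacent A d-intact d≢r)) (inj₁ (fzero , refl)))
    robberReply r' .(deleteEdge A r r') (move Arr') with r' ≟ d
    ... | yes r'≡d = inj₁ (fzero , sym r'≡d)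
    ... | no r'≢d =
      inj₂ (chase A' (smaller (deleteEdge-decreases A Arr')) A'⊆KB d c r'
                  (λ d≡c → c≢d (sym d≡c)) d-intact' c-intact' r'∼d r'≢d)
      where
      A' : Graph V
      A' = deleteEdge A r r'

      c≢r' : colour c ≢ colour r'
      c≢r' c≡r' = xor≡true⇒≢ (A⊆KB r r' Arr') (trans r∼c c≡r')

      r'∼d : colour r' ≡ colour d
      r'∼d = ≢-≢⇒≡ c≢r' c≢d

      A'⊆KB : A' ⊆ KB
      A'⊆KB x y e = A⊆KB x y (deleteEdge-⊆ A r r' x y e)

      c-intact' : Intact A' c
      c-intact' = intact-after-delete A c-intact (λ c≡r → r≢c (sym c≡r)) (colour-≢ c≢r')

      d-intact' : Intact A' d
      d-intact' = intact-after-delete A d-intact (colour-≢ d≢r) (λ d≡r' → r'≢d (sym d≡r'))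

  oneCopWins : (a b : Fin V) → colour a ≢ colour b → CopsWin KB 1
  oneCopWins a b a≢b = (λ _ → a) , start
    where
    start : ∀ r → Caught (λ (_ : Fin 1) → a) r ⊎ CopWin KB (λ _ → a) r
    start r with r ≟ a | colour r ≟ᵇ colour a
    ... | yes r≡a | _ = inj₁ (fzero , sym r≡a)
    ... | no r≢a | yes r∼a =
      inj₂ (chase KB (<-wellFounded _) (λ _ _ e → e) a b r a≢b
                  (λ _ → refl) (λ _ → refl) r∼a r≢a)
    ... | no _ | no r≁a =
      inj₂ (round (λ _ → r) (λ _ → move (≢⇒xor≡true (λ a≡r → r≁a (sym a≡r))))
                  (inj₁ (fzero , refl)))

side-↑ʳ : ∀ m {n} (i : Fin n) → side {m} {n} (m ↑ʳ i) ≡ false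
side-↑ʳ m {n} i rewrite toℕ-↑ʳ m i with m + toℕ i <ᵇ m | <ᵇ-reflects-< (m + toℕ i) m
... | false | _        = refl
... | true  | ofʸ m+i<m = contradiction m+i<m (m+n≮m m (toℕ i))

corollary2p3 : ∀ (m n : ℕ) → 0 < m → 0 < n → BridgeBurningCopNumber (K m n) 1
corollary2p3 (suc m) (suc n) _ _ =
  CompleteBipartite.oneCopWins (side {suc m} {suc n}) first second first≢second , noFewerCops
  where
  first second : Fin (suc m + suc n)
  first  = fzero
  second = suc m ↑ʳ fzero

  first≢second : side {suc m} {suc n} first ≢ side {suc m} {suc n} second
  first≢second first∼second with () ← trans first∼second (side-↑ʳ (suc m) {suc n} fzero)

  noFewerCops : ∀ j → j < 1 → ¬ CopsWin (K (suc m) (suc n)) j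
  noFewerCops zero    _         = zeroCopsLose (K (suc m) (suc n)) first
  noFewerCops (suc j) (s≤s ())
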